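{- For every complete $k$-partite graph $K_{r_1,\ldots,r_k}$ with an odd number $n=\sum_i r_i$ of vertices we have $\chi_g(K_{r_1,\ldots,r_k})\le\sum_{i=1}^k\lceil r_i/2\rceil$.
   Context: Graph coloring game: given a graph $G$ and a finite set $C$ of colors, Alice and Bob alternately (Alice first) pick an uncolored vertex and give it a legal color, i.e. a color from $C$ not used on any neighbor. The game ends when all vertices are colored (Alice wins) or when no uncolored vertex has a legal color (Bob wins). The game chromatic number $\chi_g(G)$ is the minimum $|C|$ for which Alice has a winning strategy. $K_{r_1,\ldots,r_k}$ denotes the complete $k$-partite graph with parts (independent sets) $V_1,\ldots,V_k$, $|V_i|=r_i\ge1$, $r_1\ge\cdots\ge r_k$, every two vertices in different parts adjacent; the paper assumes that if $k\ge2$ then $r_1\ge 2$. -}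

module Defs where

open import Data.Nat using (ℕ; zero; suc; _≤_; _≥_; ⌈_/2⌉; _%_)
open import Data.Fin using (Fin; toℕ) renaming (_≤_ to _≤F_)
open import Data.Fin.Properties using () renaming (_≟_ to _≟F_)
open import Data.Vec using (Vec; lookup; sum; map)
open import Data.Maybe using (Maybe; just; nothing)
open import Data.Product using (Σ; ∃; _×_; _,_; proj₁)
open import Data.Product.Properties using (≡-dec)
open import Data.Bool using (if_then_else_)
open import Relation.Nullary using (¬_; does)
open import Relation.Binary.PropositionalEquality using (_≡_; _≢_)
open import Relation.Binary.Definitions using (DecidableEquality)

module Game {V : Set} (_≟_ : DecidableEquality V) (Adj : V → V → Set) (m : ℕ) where

  -- a partial coloring: nothing = uncolored
  Coloring : Set
  Coloring = V → Maybe (Fin m)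

  empty : Coloring
  empty _ = nothing

  set : Coloring → V → Fin m → Coloring
  set c v col w = if does (w ≟ v) then just col else c w

  Complete : Coloring → Set
  Complete c = ∀ v → c v ≢ nothing

  Legal : Coloring → V → Fin m → Set
  Legal c v col = (c v ≡ nothing) × (∀ w → Adj v w → c w ≢ just col)

  -- Alice has a winning strategy from position c, with Alice (resp. Bob)
  -- to move.  Least fixed point = winning in finitely many moves.
  data AliceToMove (c : Coloring) : Set
  data BobToMove (c : Coloring) : Set

  data AliceToMove c where
    finished : Complete c → AliceToMove c
    play     : ∀ v col → Legal c v col → BobToMove (set c v col) → AliceToMove c

  data BobToMove c where
    finished : Complete c → BobToMove c
    respond  : (Σ V λ v → Σ (Fin m) λ col → Legal c v col) →
               (∀ v col → Legal c v col → AliceToMove (set c v col)) →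
               BobToMove c

  AliceWins : Set
  AliceWins = AliceToMove empty

KVertex : ∀ {k} → Vec ℕ k → Set
KVertex {k} r = Σ (Fin k) λ i → Fin (lookup r i)

_≟K_ : ∀ {k} {r : Vec ℕ k} → DecidableEquality (KVertex r)
_≟K_ = ≡-dec _≟F_ _≟F_

KAdj : ∀ {k} (r : Vec ℕ k) → KVertex r → KVertex r → Set
KAdj r u v = ¬ (proj₁ u ≡ proj₁ v)

AliceWinsK : ∀ {k} (r : Vec ℕ k) (m : ℕ) → Set
AliceWinsK r m = Game.AliceWins (_≟K_ {r = r}) (KAdj r) m

-- χ_g(K_r) ≤ s  (χ_g is the minimum m for which Alice wins)
χg≤ : ∀ {k} (r : Vec ℕ k) (s : ℕ) → Set
χg≤ r s = Σ ℕ λ m → (m ≤ s) × AliceWinsK r m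

StandingAssumptions : ∀ {k} → Vec ℕ k → Set
StandingAssumptions {k} r =
  (∀ i → lookup r i ≥ 1) ×
  (∀ (i j : Fin k) → i ≤F j → lookup r i ≥ lookup r j) ×
  -- if k ≥ 2 then r_1 ≥ 2 (r_1 = entry at index 0)
  (∀ (i : Fin k) → toℕ i ≡ 0 → 2 ≤ k → lookup r i ≥ 2)

OddOrder : ∀ {k} → Vec ℕ k → Set
OddOrder r = sum r % 2 ≡ 1

ceilHalfSum : ∀ {k} → Vec ℕ k → ℕ
ceilHalfSum r = sum (map ⌈_/2⌉ r)

-- Alice keeps a list L containing every color used so far and maintains
-- |L| + Σᵢ ⌈uᵢ/2⌉ ≤ Σᵢ ⌈rᵢ/2⌉, where uᵢ is the number of uncolored vertices of part i.
-- While some vertex is uncolored the second summand is positive, so some color lies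
-- outside L; such a color is used nowhere and is therefore legal everywhere (for Bob too).
-- Whenever an odd number of vertices is uncolored (as at the start), she colors a vertex
-- of a part with odd uᵢ with such a fresh color.  When Bob colors a vertex of part i,
-- she repeats his color in part i (vertices of a part have the same neighbours); if
-- part i is now full, Bob used its last vertex and she makes the odd-part move instead.
-- Counting a move of Bob together with Alice's copy of it (if any), every step puts
-- one color into L and lowers Σᵢ ⌈uᵢ/2⌉ by exactly one.

module Submission where

open import Defs
open import Data.Nat using (ℕ; zero; suc; _+_; _≤_; _<_; ⌈_/2⌉; _%_; z<s; parity)
open import Data.Nat.Properties
  using ( +-0-commutativeMonoid; ≤-refl; ≤-reflexive; ≤-trans; m≤m+n; m<m+n; +-suc
        ; suc-injective; <-irrefl; ⌈n/2⌉-mono; module ≤-Reasoning)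
open import Data.Parity.Base using (0ℙ; 1ℙ)
open import Data.Parity.Properties using (+-homo-+)
open import Data.Fin using (Fin; zero; suc)
open import Data.Fin.Properties using (any?; punchInᵢ≢i; <⇒notInjective) renaming (_≟_ to _≟F_)
open import Data.Vec as Vec using (Vec; []; _∷_; lookup)
open import Data.Vec.Properties using (lookup-map)
open import Data.Vec.Functional using (removeAt)
open import Data.List as List using (List; []; _∷_; length)
open import Data.List.Membership.Propositional using (_∈_; _∉_)
import Data.List.Membership.DecPropositional as DecMembership
open import Data.List.Relation.Unary.Any using (here; there; index)
open import Data.List.Relation.Unary.Any.Properties using (lookup-index)
open import Data.Maybe using (Maybe; just; nothing)
open import Data.Maybe.Properties using (just-injective)
open import Data.Product using (∃; _×_; _,_; proj₁)
import Data.Product as Product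
open import Function using (_∘_; id)
open import Data.Empty using (⊥-elim)
open import Relation.Nullary using (yes; no; ¬?)
open import Relation.Nullary.Decidable using (dec-true; dec-false; decidable-stable)
open import Data.Bool using (if_then_else_)
open import Relation.Binary.PropositionalEquality
open import Relation.Binary.Definitions using (DecidableEquality)
open import Algebra.Properties.CommutativeMonoid.Sum +-0-commutativeMonoid
  using (sum; sum-syntax; sum-remove; sum-cong-≗)

Even Odd : ℕ → Set
Even n = parity n ≡ 0ℙ
Odd  n = parity n ≡ 1ℙ

%2≡1⇒suc-even : ∀ n → n % 2 ≡ 1 → ∃ λ N → n ≡ suc N × Even N
%2≡1⇒suc-even (suc zero)    _ = 0 , refl , refl
%2≡1⇒suc-even (suc (suc n)) p with %2≡1⇒suc-even n p
... | N , n≡1+N , even = suc (suc N) , cong (2 +_) n≡1+N , even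

even⇒odd-suc : ∀ {n} → Even n → Odd (suc n)
even⇒odd-suc {zero}        _ = refl
even⇒odd-suc {suc (suc n)} p = even⇒odd-suc {n} p

odd⇒0< : ∀ {n} → Odd n → 0 < n
odd⇒0< {suc _} _ = z<s

odd⇒⌈1+n/2⌉≡1+⌈n/2⌉ : ∀ n → Odd (suc n) → ⌈ suc n /2⌉ ≡ suc ⌈ n /2⌉
odd⇒⌈1+n/2⌉≡1+⌈n/2⌉ zero          _ = refl
odd⇒⌈1+n/2⌉≡1+⌈n/2⌉ (suc (suc n)) p = cong suc (odd⇒⌈1+n/2⌉≡1+⌈n/2⌉ n p)

∑-lookup : ∀ {k} (r : Vec ℕ k) → Vec.sum r ≡ ∑[ i < k ] lookup r i
∑-lookup []      = refl
∑-lookup (x ∷ r) = cong (x +_) (∑-lookup r)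

∑-ones : ∀ n → ∑[ i < n ] 1 ≡ n
∑-ones zero    = refl
∑-ones (suc n) = cong suc (∑-ones n)

≤-∑ : ∀ {k} (f : Fin k → ℕ) i → f i ≤ sum f
≤-∑ {suc _} f i = subst (f i ≤_) (sym (sum-remove {i = i} f)) (m≤m+n (f i) _)

∑-positive : ∀ {k} (f : Fin k → ℕ) → 0 < sum f → ∃ λ i → 0 < f i
∑-positive {suc _} f 0<∑ with f zero in f₀≡
... | suc _ = zero , subst (0 <_) (sym f₀≡) z<s
... | zero  = Product.map suc id (∑-positive (f ∘ suc) 0<∑)

∑-odd : ∀ {k} (f : Fin k → ℕ) → Odd (sum f) → ∃ λ i → Odd (f i)
∑-odd {suc _} f odd rewrite +-homo-+ (f zero) (sum (f ∘ suc)) with parity (f zero) in p₀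
... | 1ℙ = zero , p₀
... | 0ℙ = Product.map suc id (∑-odd (f ∘ suc) odd)

∑-update : ∀ {k} (f g : Fin k → ℕ) i → f i ≡ suc (g i) → (∀ j → j ≢ i → f j ≡ g j) →
           sum f ≡ suc (sum g)
∑-update {suc _} f g i fᵢ≡1+gᵢ f≗g = begin
  sum f                          ≡⟨ sum-remove f ⟩
  f i + sum (removeAt f i)       ≡⟨ cong₂ _+_ fᵢ≡1+gᵢ (sum-cong-≗ λ j → f≗g _ (punchInᵢ≢i i j)) ⟩
  suc (g i + sum (removeAt g i)) ≡⟨ cong suc (sum-remove g) ⟨
  suc (sum g)                    ∎
  where open ≡-Reasoning

length<⇒∃∉ : ∀ {m} (xs : List (Fin m)) → length xs < m → ∃ λ x → x ∉ xs
length<⇒∃∉ xs |xs|<m with any? (λ x → ¬? (DecMembership._∈?_ _≟F_ x xs))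
... | yes x∉xs = x∉xs
... | no ∄x∉xs = ⊥-elim (<⇒notInjective |xs|<m position-injective)
  where
  member : ∀ x → x ∈ xs
  member x = decidable-stable (DecMembership._∈?_ _≟F_ x xs) (λ x∉xs → ∄x∉xs (x , x∉xs))
  position-injective : ∀ {x y} → index (member x) ≡ index (member y) → x ≡ y
  position-injective {x} {y} eq =
    trans (lookup-index (member x)) (trans (cong (List.lookup xs) eq) (sym (lookup-index (member y))))

count-nothing : ∀ {A : Set} → Maybe A → ℕ
count-nothing nothing  = 1
count-nothing (just _) = 0

0<count-nothing⇒≡nothing : ∀ {A : Set} {a : Maybe A} → 0 < count-nothing a → a ≡ nothing
0<count-nothing⇒≡nothing {a = nothing} _ = refl

module Strategy {k : ℕ} (r : Vec ℕ k) where

  m : ℕ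
  m = ceilHalfSum r

  _≟V_ : DecidableEquality (KVertex r)
  _≟V_ = _≟K_ {r = r}

  open Game _≟V_ (KAdj r) m

  set-≡ : ∀ c v col → set c v col v ≡ just col
  set-≡ c v col = cong (λ b → if b then just col else c v) (dec-true (v ≟V v) refl)

  set-≢ : ∀ c v col {w} → w ≢ v → set c v col w ≡ c w
  set-≢ c v col {w} w≢v = cong (λ b → if b then just col else c w) (dec-false (w ≟V v) w≢v)

  uncoloredIn : Coloring → Fin k → ℕ
  uncoloredIn c i = ∑[ x < lookup r i ] count-nothing (c (i , x))

  uncolored : Coloring → ℕ
  uncolored c = ∑[ i < k ] uncoloredIn c i

  reserve : Coloring → ℕ
  reserve c = ∑[ i < k ] ⌈ uncoloredIn c i /2⌉

  uncoloredIn-set-≡ : ∀ c i x col → c (i , x) ≡ nothing →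
                      uncoloredIn c i ≡ suc (uncoloredIn (set c (i , x) col) i)
  uncoloredIn-set-≡ c i x col cᵢₓ≡nothing = ∑-update _ _ x here-counts elsewhere
    where
    here-counts : count-nothing (c (i , x)) ≡ suc (count-nothing (set c (i , x) col (i , x)))
    here-counts = trans (cong count-nothing cᵢₓ≡nothing)
                        (cong (λ a → suc (count-nothing a)) (sym (set-≡ c (i , x) col)))
    elsewhere : ∀ y → y ≢ x → count-nothing (c (i , y)) ≡ count-nothing (set c (i , x) col (i , y))
    elsewhere y y≢x = cong count-nothing (sym (set-≢ c (i , x) col λ { refl → y≢x refl }))

  uncoloredIn-set-≢ : ∀ c v col i → i ≢ proj₁ v → uncoloredIn (set c v col) i ≡ uncoloredIn c i
  uncoloredIn-set-≢ c v col i i≢ =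
    sum-cong-≗ λ x → cong count-nothing (set-≢ c v col {i , x} (i≢ ∘ cong proj₁))

  uncolored-set : ∀ c v col → c v ≡ nothing → uncolored c ≡ suc (uncolored (set c v col))
  uncolored-set c (i , x) col cᵢₓ≡nothing =
    ∑-update _ _ i (uncoloredIn-set-≡ c i x col cᵢₓ≡nothing)
                   λ j j≢i → sym (uncoloredIn-set-≢ c (i , x) col j j≢i)

  reserve-step : ∀ c c' i → ⌈ uncoloredIn c i /2⌉ ≡ suc ⌈ uncoloredIn c' i /2⌉ →
                 (∀ j → j ≢ i → uncoloredIn c' j ≡ uncoloredIn c j) → reserve c ≡ suc (reserve c')
  reserve-step c c' i step same = ∑-update _ _ i step λ j j≢i → cong ⌈_/2⌉ (sym (same j j≢i))

  0<uncoloredIn : ∀ c i x → c (i , x) ≡ nothing → 0 < uncoloredIn c i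
  0<uncoloredIn c i x cᵢₓ≡nothing =
    subst (_≤ uncoloredIn c i) (cong count-nothing cᵢₓ≡nothing)
          (≤-∑ (λ y → count-nothing (c (i , y))) x)

  0<reserve : ∀ c i x → c (i , x) ≡ nothing → 0 < reserve c
  0<reserve c i x cᵢₓ≡nothing =
    ≤-trans (⌈n/2⌉-mono (0<uncoloredIn c i x cᵢₓ≡nothing))
            (≤-∑ (λ j → ⌈ uncoloredIn c j /2⌉) i)

  uncolored≡0⇒complete : ∀ c → uncolored c ≡ 0 → Complete c
  uncolored≡0⇒complete c U≡0 (i , x) cᵢₓ≡nothing = <-irrefl refl (subst (0 <_) U≡0 0<U)
    where
    0<U : 0 < uncolored c
    0<U = ≤-trans (0<uncoloredIn c i x cᵢₓ≡nothing) (≤-∑ (uncoloredIn c) i)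

  uncoloredIn-witness : ∀ c i → 0 < uncoloredIn c i → ∃ λ x → c (i , x) ≡ nothing
  uncoloredIn-witness c i 0<u =
    Product.map₂ 0<count-nothing⇒≡nothing (∑-positive (λ x → count-nothing (c (i , x))) 0<u)

  uncolored-witness : ∀ c → 0 < uncolored c → ∃ λ v → c v ≡ nothing
  uncolored-witness c 0<U with ∑-positive (uncoloredIn c) 0<U
  ... | i , 0<u = Product.map (i ,_) id (uncoloredIn-witness c i 0<u)

  Covers : Coloring → List (Fin m) → Set
  Covers c L = ∀ v {col} → c v ≡ just col → col ∈ L

  covers-set : ∀ {c L} v col → Covers c L → col ∈ L → Covers (set c v col) L
  covers-set {c} {L} v col cov col∈L w c′w≡just with w ≟V v
  ... | yes _ = subst (_∈ L) (just-injective c′w≡just) col∈L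
  ... | no  _ = cov w c′w≡just

  covers-set-∷ : ∀ {c L} v col → Covers c L → Covers (set c v col) (col ∷ L)
  covers-set-∷ v col cov = covers-set v col (λ w → there ∘ cov w) (here refl)

  record Invariant (c : Coloring) (L : List (Fin m)) : Set where
    field
      covers : Covers c L
      budget : length L + reserve c ≤ m

  open Invariant

  invariant-step : ∀ {c c' L col} → Invariant c L → Covers c' (col ∷ L) →
                   reserve c ≡ suc (reserve c') → Invariant c' (col ∷ L)
  invariant-step {c} {c'} {L} inv cov′ reserve≡ = record { covers = cov′ ; budget = budget′ }
    where
    open ≤-Reasoning
    budget′ : suc (length L) + reserve c' ≤ m
    budget′ = begin
      suc (length L + reserve c') ≡⟨ +-suc (length L) (reserve c') ⟨
      length L + suc (reserve c') ≡⟨ cong (length L +_) reserve≡ ⟨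
      length L + reserve c        ≤⟨ budget inv ⟩
      m                           ∎

  freshMove : ∀ {c L} → Invariant c L → ∀ v → c v ≡ nothing → ∃ λ col → Legal c v col
  freshMove {c} {L} inv (i , x) cᵢₓ≡nothing with length<⇒∃∉ L |L|<m
    where
    open ≤-Reasoning
    |L|<m : length L < m
    |L|<m = begin-strict
      length L            <⟨ m<m+n (length L) (0<reserve c i x cᵢₓ≡nothing) ⟩
      length L + reserve c ≤⟨ budget inv ⟩
      m                    ∎
  ... | col , col∉L = col , cᵢₓ≡nothing , λ w _ c-w≡col → col∉L (covers inv w c-w≡col)

  copy-legal : ∀ c i x y col → Legal c (i , x) col → set c (i , x) col (i , y) ≡ nothing →
               Legal (set c (i , x) col) (i , y) col
  copy-legal c i x y col (_ , unused) c′ᵢᵧ≡nothing =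
    c′ᵢᵧ≡nothing , λ w i≢w c′w≡col →
      unused w i≢w (trans (sym (set-≢ c (i , x) col λ w≡ → i≢w (cong proj₁ (sym w≡)))) c′w≡col)

  aliceWins : ∀ N {c L} → Invariant c L → uncolored c ≡ suc N → Even N → AliceToMove c
  bobLoses : ∀ N {c L} → Invariant c L → uncolored c ≡ N → Even N → BobToMove c
  aliceAnswers : ∀ N {c L} → Invariant c L → uncolored c ≡ suc (suc N) → Even N →
                 ∀ v col → Legal c v col → AliceToMove (set c v col)

  aliceWins N {c} {L} inv U≡ even
    with ∑-odd (uncoloredIn c) (subst Odd (sym U≡) (even⇒odd-suc {N} even))
  ... | i , oddᵢ with uncoloredIn-witness c i (odd⇒0< oddᵢ)
  ...   | x , cᵢₓ≡nothing with freshMove inv (i , x) cᵢₓ≡nothing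
  ...     | col , legal = play (i , x) col legal (bobLoses N inv′ U′≡ even)
    where
    c′ = set c (i , x) col
    uᵢ≡ : uncoloredIn c i ≡ suc (uncoloredIn c′ i)
    uᵢ≡ = uncoloredIn-set-≡ c i x col cᵢₓ≡nothing
    halfᵢ : ⌈ uncoloredIn c i /2⌉ ≡ suc ⌈ uncoloredIn c′ i /2⌉
    halfᵢ = trans (cong ⌈_/2⌉ uᵢ≡) (odd⇒⌈1+n/2⌉≡1+⌈n/2⌉ _ (subst Odd uᵢ≡ oddᵢ))
    inv′ : Invariant c′ (col ∷ L)
    inv′ = invariant-step inv (covers-set-∷ (i , x) col (covers inv))
             (reserve-step c c′ i halfᵢ λ j j≢i → uncoloredIn-set-≢ c (i , x) col j j≢i)
    U′≡ : uncolored c′ ≡ N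
    U′≡ = suc-injective (trans (sym (uncolored-set c (i , x) col cᵢₓ≡nothing)) U≡)

  bobLoses zero          {c} _ U≡0 _ = finished (uncolored≡0⇒complete c U≡0)
  bobLoses (suc (suc N)) {c} inv U≡ even with uncolored-witness c (subst (0 <_) (sym U≡) z<s)
  ... | v , cv≡nothing = respond (v , freshMove inv v cv≡nothing) (aliceAnswers N inv U≡ even)

  aliceAnswers N {c} {L} inv U≡ even (i , x) col legal with uncoloredIn (set c (i , x) col) i in u₁≡
  ... | zero = aliceWins N inv₁ U₁≡ even
    where
    c₁ = set c (i , x) col
    halfᵢ : ⌈ uncoloredIn c i /2⌉ ≡ suc ⌈ uncoloredIn c₁ i /2⌉
    halfᵢ rewrite uncoloredIn-set-≡ c i x col (proj₁ legal) | u₁≡ = refl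
    inv₁ : Invariant c₁ (col ∷ L)
    inv₁ = invariant-step inv (covers-set-∷ (i , x) col (covers inv))
             (reserve-step c c₁ i halfᵢ λ j j≢i → uncoloredIn-set-≢ c (i , x) col j j≢i)
    U₁≡ : uncolored c₁ ≡ suc N
    U₁≡ = suc-injective (trans (sym (uncolored-set c (i , x) col (proj₁ legal))) U≡)
  ... | suc _ with uncoloredIn-witness (set c (i , x) col) i (subst (0 <_) (sym u₁≡) z<s)
  ...   | y , c₁ᵢᵧ≡nothing =
    play (i , y) col (copy-legal c i x y col legal c₁ᵢᵧ≡nothing) (bobLoses N inv₂ U₂≡ even)
    where
    c₁ = set c (i , x) col
    c₂ = set c₁ (i , y) col
    uᵢ≡ : uncoloredIn c i ≡ suc (suc (uncoloredIn c₂ i))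
    uᵢ≡ = trans (uncoloredIn-set-≡ c i x col (proj₁ legal))
                (cong suc (uncoloredIn-set-≡ c₁ i y col c₁ᵢᵧ≡nothing))
    inv₂ : Invariant c₂ (col ∷ L)
    inv₂ = invariant-step inv
             (covers-set (i , y) col (covers-set-∷ (i , x) col (covers inv)) (here refl))
             (reserve-step c c₂ i (cong ⌈_/2⌉ uᵢ≡) λ j j≢i →
               trans (uncoloredIn-set-≢ c₁ (i , y) col j j≢i) (uncoloredIn-set-≢ c (i , x) col j j≢i))
    U₂≡ : uncolored c₂ ≡ N
    U₂≡ = suc-injective (suc-injective (begin
      suc (suc (uncolored c₂)) ≡⟨ cong suc (uncolored-set c₁ (i , y) col c₁ᵢᵧ≡nothing) ⟨
      suc (uncolored c₁)       ≡⟨ uncolored-set c (i , x) col (proj₁ legal) ⟨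
      uncolored c              ≡⟨ U≡ ⟩
      suc (suc N)              ∎))
      where open ≡-Reasoning

  initial : Invariant empty []
  initial = record { covers = λ _ () ; budget = ≤-reflexive reserve-empty }
    where
    reserve-empty : reserve empty ≡ m
    reserve-empty = begin
      ∑[ i < k ] ⌈ uncoloredIn empty i /2⌉ ≡⟨ sum-cong-≗ (λ i → cong ⌈_/2⌉ (∑-ones (lookup r i))) ⟩
      ∑[ i < k ] ⌈ lookup r i /2⌉          ≡⟨ sum-cong-≗ (λ i → lookup-map i ⌈_/2⌉ r) ⟨
      ∑[ i < k ] lookup (Vec.map ⌈_/2⌉ r) i ≡⟨ ∑-lookup (Vec.map ⌈_/2⌉ r) ⟨
      m                                    ∎
      where open ≡-Reasoning

  uncolored-empty : uncolored empty ≡ Vec.sum r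
  uncolored-empty = trans (sum-cong-≗ λ i → ∑-ones (lookup r i)) (sym (∑-lookup r))

  aliceWinsOdd : OddOrder r → AliceWinsK r m
  aliceWinsOdd odd with %2≡1⇒suc-even (Vec.sum r) odd
  ... | N , n≡1+N , even = aliceWins N initial (trans uncolored-empty n≡1+N) even

corollary3 : (k : ℕ) (r : Vec ℕ k) → StandingAssumptions r → OddOrder r →
    χg≤ r (ceilHalfSum r)
corollary3 _ r _ odd = ceilHalfSum r , ≤-refl , Strategy.aliceWinsOdd r odd
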